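{- Let $G$ be a connected $k$-regular undirected graph with $k\ge3$ and let $U=U(G)$ be its Grover transfer matrix. For arcs $a,b\in A(G)$: $(U^2)_{ab}>0$ if and only if either $a=b$, or [$t(b)$ is adjacent to $o(a)$ and none of $a=b$, ($o(a)=o(b)$, $a\ne b$), ($t(a)=t(b)$, $a\ne b$) holds]; and $(U^2)_{ab}<0$ if and only if either ($o(a)=o(b)$ and $a\ne b$) or ($t(a)=t(b)$ and $a\ne b$).
   Context: For a finite simple connected undirected graph $G$, $A(G)=\{(u,v),(v,u)\mid uv\in E(G)\}$; for $a=(u,v)$, $o(a)=u$, $t(a)=v$, $a^{ -1}=(v,u)$. The Grover transfer matrix $U$ is indexed by $A(G)$ with $U_{ab}=\frac{2}{\deg t(b)}\delta_{t(b),o(a)}-\delta_{a^{ -1},b}$. -}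

module Defs where

open import Data.Nat using (ℕ; zero; suc)
import Data.Nat as ℕ
open import Data.Fin using (Fin; _≟_)
open import Data.List using (List; foldr; map; allFin)
open import Data.Bool using (Bool; true; false; T; if_then_else_)
open import Data.Unit using (tt)
open import Data.Product using (Σ; _,_; proj₁; proj₂)
open import Data.Integer using (+_)
open import Data.Rational using (ℚ; 0ℚ; 1ℚ; _+_; _-_; _*_; _/_)
open import Relation.Binary.PropositionalEquality using (_≡_)
open import Relation.Nullary.Decidable using (⌊_⌋)

record Graph : Set where
  field
    n      : ℕ
    adj    : Fin n → Fin n → Bool
    adj-sym    : ∀ u v → adj u v ≡ adj v u
    adj-irrefl : ∀ u → adj u u ≡ false
open Graph public

module _ (G : Graph) where

  Arc : Set
  Arc = Σ (Fin (n G)) λ u → Σ (Fin (n G)) λ v → T (adj G u v)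

  o : Arc → Fin (n G)
  o a = proj₁ a

  t : Arc → Fin (n G)
  t a = proj₁ (proj₂ a)

  inv : Arc → Arc
  inv (u , v , e) = v , u , e'
    where
    e' : T (adj G v u)
    e' rewrite adj-sym G v u = e

  sumℕ : List (Fin (n G)) → (Fin (n G) → ℕ) → ℕ
  sumℕ xs f = foldr (λ x acc → f x ℕ.+ acc) 0 xs

  sumℚ : List (Fin (n G)) → (Fin (n G) → ℚ) → ℚ
  sumℚ xs f = foldr (λ x acc → f x + acc) 0ℚ xs

  deg : Fin (n G) → ℕ
  deg v = sumℕ (allFin (n G)) λ w → if adj G v w then 1 else 0

  Regular : ℕ → Set
  Regular k = ∀ v → deg v ≡ k

  data Reach : Fin (n G) → Fin (n G) → Set where
    here : ∀ {v} → Reach v v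
    step : ∀ {u w v} → T (adj G u w) → Reach w v → Reach u v

  Connected : Set
  Connected = ∀ u v → Reach u v

  arcTerm : (b : Bool) → (T b → ℚ) → ℚ
  arcTerm true  f = f tt
  arcTerm false f = 0ℚ

  sumArcs : (Arc → ℚ) → ℚ
  sumArcs f = sumℚ (allFin (n G)) λ u → sumℚ (allFin (n G)) λ v →
                arcTerm (adj G u v) (λ e → f (u , v , e))

  -- 2 / d  (only used with d = deg t(b) ≥ 1, since b is an arc)
  twoOver : ℕ → ℚ
  twoOver zero    = 0ℚ
  twoOver (suc m) = + 2 / suc m

  δV : Fin (n G) → Fin (n G) → ℚ
  δV x y = if ⌊ x ≟ y ⌋ then 1ℚ else 0ℚ

  -- δ_{a⁻¹, b}: arcs are determined by their endpoints
  δA : Arc → Arc → ℚ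
  δA a b = if ⌊ o a ≟ o b ⌋ then (if ⌊ t a ≟ t b ⌋ then 1ℚ else 0ℚ) else 0ℚ

  U : Arc → Arc → ℚ
  U a b = twoOver (deg (t b)) * δV (t b) (o a) - δA (inv a) b

  U² : Arc → Arc → ℚ
  U² a b = sumArcs λ c → U a c * U c b

module Submission where

-- Write q = 2/k.  The entry U_{ac} vanishes unless t(c) = o(a), and then it
-- equals q - [t(a) = o(c)].  Hence in (U²)_{ab} = Σ_c U_{ac} U_{cb} the only
-- arc that can contribute is c = (t(b), o(a)), and
--
--   (U²)_{ab} = [t(b) ~ o(a)] · (q - [t(a) = t(b)]) · (q - [o(a) = o(b)]).
--
-- Since 0 < q < 1, a factor q - [x = y] is negative exactly when x = y, so the
-- sign of (U²)_{ab} depends only on how the arcs a, b sit relative to each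
-- other: they are identical (+), siblings sharing an origin or a target (-),
-- linked by an edge t(b) ~ o(a) otherwise (+), or unlinked (0).

open import Defs
open import Data.Nat using (ℕ; _≤_; suc; s≤s; z≤n)
open import Data.Fin using (Fin; _≟_)
import Data.Fin as F
open import Data.Fin.Properties using (suc-injective)
open import Data.List using (List; foldr; tabulate)
open import Data.Bool using (Bool; true; false; T; if_then_else_)
open import Data.Bool.Properties using (T?; T-irrelevant)
open import Data.Unit using (tt)
open import Data.Empty using (⊥-elim)
open import Data.Product using (_×_; _,_; proj₁; proj₂)
open import Data.Sum using (_⊎_; inj₁; inj₂)
import Data.Integer as ℤ
open import Data.Rational
  using (ℚ; 0ℚ; 1ℚ; _+_; _-_; _*_; -_; _<_; positive; negative)
import Data.Rational.Properties as ℚ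
import Data.Rational.Unnormalised as ℚᵘ
import Data.Rational.Unnormalised.Properties as ℚᵘ
open import Relation.Binary.PropositionalEquality
  using (_≡_; _≢_; refl; sym; trans; cong; cong₂; subst; module ≡-Reasoning)
open import Relation.Nullary using (¬_; yes; no)
open import Relation.Nullary.Decidable using (⌊_⌋)
open import Function.Bundles using (_⇔_; mk⇔)

pos*pos : ∀ {p r} → 0ℚ < p → 0ℚ < r → 0ℚ < p * r
pos*pos {p} {r} 0<p 0<r =
  ℚ.positive⁻¹ (p * r) {{ℚ.pos*pos⇒pos p {{positive 0<p}} r {{positive 0<r}}}}

neg*neg : ∀ {p r} → p < 0ℚ → r < 0ℚ → 0ℚ < p * r
neg*neg {p} {r} p<0 r<0 =
  ℚ.positive⁻¹ (p * r) {{ℚ.neg*neg⇒pos p {{negative p<0}} r {{negative r<0}}}}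

pos*neg : ∀ {p r} → 0ℚ < p → r < 0ℚ → p * r < 0ℚ
pos*neg {p} {r} 0<p r<0 =
  ℚ.negative⁻¹ (p * r) {{ℚ.pos*neg⇒neg p {{positive 0<p}} r {{negative r<0}}}}

neg*pos : ∀ {p r} → p < 0ℚ → 0ℚ < r → p * r < 0ℚ
neg*pos {p} {r} p<0 0<r =
  ℚ.negative⁻¹ (p * r) {{ℚ.neg*pos⇒neg p {{negative p<0}} r {{positive 0<r}}}}

-- Finite sums, in the right-nested form used by `sumℚ` and `sumArcs`.

sumOver : {A : Set} → (A → ℚ) → List A → ℚ
sumOver f = foldr (λ x acc → f x + acc) 0ℚ

sumOver-zero : {A : Set} {m : ℕ} (g : Fin m → A) (f : A → ℚ) →
               (∀ j → f (g j) ≡ 0ℚ) → sumOver f (tabulate g) ≡ 0ℚ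
sumOver-zero {m = 0}     g f f≡0 = refl
sumOver-zero {m = suc m} g f f≡0 =
  cong₂ _+_ (f≡0 F.zero) (sumOver-zero (λ j → g (F.suc j)) f (λ j → f≡0 (F.suc j)))

sumOver-single : {A : Set} {m : ℕ} (g : Fin m → A) (f : A → ℚ) (i : Fin m) →
                 (∀ j → j ≢ i → f (g j) ≡ 0ℚ) → sumOver f (tabulate g) ≡ f (g i)
sumOver-single {m = suc m} g f F.zero f≡0 = begin
  f (g F.zero) + sumOver f (tabulate (λ j → g (F.suc j)))
    ≡⟨ cong (f (g F.zero) +_) (sumOver-zero _ f (λ j → f≡0 (F.suc j) (λ ()))) ⟩
  f (g F.zero) + 0ℚ
    ≡⟨ ℚ.+-identityʳ _ ⟩
  f (g F.zero) ∎
  where open ≡-Reasoning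
sumOver-single {m = suc m} g f (F.suc i) f≡0 = begin
  f (g F.zero) + sumOver f (tabulate (λ j → g (F.suc j)))
    ≡⟨ cong (_+ sumOver f (tabulate (λ j → g (F.suc j)))) (f≡0 F.zero (λ ())) ⟩
  0ℚ + sumOver f (tabulate (λ j → g (F.suc j)))
    ≡⟨ ℚ.+-identityˡ _ ⟩
  sumOver f (tabulate (λ j → g (F.suc j)))
    ≡⟨ sumOver-single _ f i (λ j j≢i → f≡0 (F.suc j) (λ eq → j≢i (suc-injective eq))) ⟩
  f (g (F.suc i)) ∎
  where open ≡-Reasoning

module _ (G : Graph) where

  V : Set
  V = Fin (n G)

  arcTerm-zero : (b : Bool) (f : T b → ℚ) → (∀ e → f e ≡ 0ℚ) → arcTerm G b f ≡ 0ℚ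
  arcTerm-zero true  f f≡0 = f≡0 tt
  arcTerm-zero false f f≡0 = refl

  arcTerm-edge : (b : Bool) (f : T b → ℚ) (e : T b) → arcTerm G b f ≡ f e
  arcTerm-edge true f tt = refl

  arcTerm-no-edge : (b : Bool) (f : T b → ℚ) → ¬ T b → arcTerm G b f ≡ 0ℚ
  arcTerm-no-edge true  f ¬e = ⊥-elim (¬e tt)
  arcTerm-no-edge false f ¬e = refl

  δV-same : {x y : V} → x ≡ y → δV G x y ≡ 1ℚ
  δV-same {x} {y} x≡y with x ≟ y
  ... | yes _   = refl
  ... | no  x≢y = ⊥-elim (x≢y x≡y)

  δV-distinct : {x y : V} → x ≢ y → δV G x y ≡ 0ℚ
  δV-distinct {x} {y} x≢y with x ≟ y
  ... | yes x≡y = ⊥-elim (x≢y x≡y)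
  ... | no  _   = refl

  δA-distinct-targets : (a b : Arc G) → t G a ≢ t G b → δA G a b ≡ 0ℚ
  δA-distinct-targets a b ta≢tb with o G a ≟ o G b
  ... | yes _ = δV-distinct ta≢tb
  ... | no  _ = refl

  reverse-edge : (a : Arc G) → T (adj G (t G a) (o G a))
  reverse-edge (u , v , e) = subst T (adj-sym G u v) e

  arc-≡ : (a b : Arc G) → o G a ≡ o G b → t G a ≡ t G b → a ≡ b
  arc-≡ (u , v , e) (.u , .v , e′) refl refl = cong (λ d → u , v , d) (T-irrelevant e e′)

  U-vanishes : (a c : Arc G) → t G c ≢ o G a → U G a c ≡ 0ℚ
  U-vanishes (u , v , e) (x , y , e′) y≢u = begin
    twoOver G (deg G y) * δV G y u - δA G (inv G (u , v , e)) (x , y , e′)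
      ≡⟨ cong₂ _-_ (cong (twoOver G (deg G y) *_) (δV-distinct y≢u))
                (δA-distinct-targets (inv G (u , v , e)) (x , y , e′) (λ u≡y → y≢u (sym u≡y))) ⟩
    twoOver G (deg G y) * 0ℚ - 0ℚ
      ≡⟨ cong (_- 0ℚ) (ℚ.*-zeroʳ (twoOver G (deg G y))) ⟩
    0ℚ ∎
    where open ≡-Reasoning

  U-consecutive : (a : Arc G) (x : V) (e : T (adj G x (o G a))) →
                  U G a (x , o G a , e) ≡ twoOver G (deg G (o G a)) - δV G (t G a) x
  U-consecutive (u , v , _) x e = begin
    twoOver G (deg G u) * δV G u u - (if ⌊ v ≟ x ⌋ then δV G u u else 0ℚ)
      ≡⟨ cong (λ d → twoOver G (deg G u) * d - (if ⌊ v ≟ x ⌋ then d else 0ℚ)) (δV-same refl) ⟩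
    twoOver G (deg G u) * 1ℚ - δV G v x
      ≡⟨ cong (_- δV G v x) (ℚ.*-identityʳ (twoOver G (deg G u))) ⟩
    twoOver G (deg G u) - δV G v x ∎
    where open ≡-Reasoning

  U²-concentrated : (a b : Arc G) → U² G a b ≡
    arcTerm G (adj G (t G b) (o G a))
      (λ e → U G a (t G b , o G a , e) * U G (t G b , o G a , e) b)
  U²-concentrated a b =
    trans (sumOver-single (λ u → u) _ (t G b) off-target)
          (sumOver-single (λ v → v) _ (o G a) off-origin)
    where
    off-target : ∀ u → u ≢ t G b →
      sumOver (λ v → arcTerm G (adj G u v) (λ e → U G a (u , v , e) * U G (u , v , e) b))
              (tabulate (λ v → v)) ≡ 0ℚ
    off-target u u≢tb = sumOver-zero (λ v → v) _ λ v → arcTerm-zero (adj G u v) _ λ e →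
      trans (cong (U G a (u , v , e) *_) (U-vanishes (u , v , e) b (λ tb≡u → u≢tb (sym tb≡u)))) (ℚ.*-zeroʳ (U G a (u , v , e)))
    off-origin : ∀ v → v ≢ o G a →
      arcTerm G (adj G (t G b) v) (λ e → U G a (t G b , v , e) * U G (t G b , v , e) b) ≡ 0ℚ
    off-origin v v≢oa = arcTerm-zero (adj G (t G b) v) _ λ e →
      trans (cong (_* U G (t G b , v , e) b) (U-vanishes a (t G b , v , e) v≢oa)) (ℚ.*-zeroˡ (U G (t G b , v , e) b))

  U²-unlinked : (a b : Arc G) → ¬ T (adj G (t G b) (o G a)) → U² G a b ≡ 0ℚ
  U²-unlinked a b ¬e = trans (U²-concentrated a b) (arcTerm-no-edge _ _ ¬e)

  Siblings : Arc G → Arc G → Set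
  Siblings a b = (o G a ≡ o G b × a ≢ b) ⊎ (t G a ≡ t G b × a ≢ b)

  data Configuration (a b : Arc G) : Set where
    identical : a ≡ b → Configuration a b
    siblings  : Siblings a b → Configuration a b
    linked    : T (adj G (t G b) (o G a)) → o G a ≢ o G b → t G a ≢ t G b →
                Configuration a b
    unlinked  : ¬ T (adj G (t G b) (o G a)) → Configuration a b

  classify : (a b : Arc G) → Configuration a b
  classify a b with o G a ≟ o G b | t G a ≟ t G b
  ... | yes oa≡ob | yes ta≡tb = identical (arc-≡ a b oa≡ob ta≡tb)
  ... | yes oa≡ob | no  ta≢tb = siblings (inj₁ (oa≡ob , λ a≡b → ta≢tb (cong (t G) a≡b)))
  ... | no  oa≢ob | yes ta≡tb = siblings (inj₂ (ta≡tb , λ a≡b → oa≢ob (cong (o G) a≡b)))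
  ... | no  oa≢ob | no  ta≢tb with T? (adj G (t G b) (o G a))
  ...   | yes e  = linked e oa≢ob ta≢tb
  ...   | no  ¬e = unlinked ¬e

  -- 0 < 2/k < 1 as soon as k ≥ 3; the upper bound is checked on the
  -- unnormalised fraction 2/k, whose normalisation is 2/k itself.
  twoOver-bounds : (k : ℕ) → 3 ≤ k → 0ℚ < twoOver G k × twoOver G k < 1ℚ
  twoOver-bounds (suc (suc (suc k))) (s≤s (s≤s (s≤s z≤n))) =
    ℚ.positive⁻¹ _ {{ℚ.normalize-pos 2 (suc (suc (suc k)))}} ,
    ℚ.toℚᵘ-cancel-<
      (ℚᵘ.<-respˡ-≃ (ℚᵘ.≃-sym (ℚ.toℚᵘ-fromℚᵘ (ℚᵘ.mkℚᵘ (ℤ.+ 2) (suc (suc k)))))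
                    (ℚᵘ.*<* (ℤ.+<+ (s≤s (s≤s (s≤s z≤n))))))

  module RegularSigns (k : ℕ) (regular : Regular G k)
                      (bounds : 0ℚ < twoOver G k × twoOver G k < 1ℚ) where

    q : ℚ
    q = twoOver G k

    U²-linked : (a b : Arc G) → T (adj G (t G b) (o G a)) →
      U² G a b ≡ (q - δV G (t G a) (t G b)) * (q - δV G (o G a) (o G b))
    U²-linked a@(ua , va , ea) b@(ub , vb , eb) e = begin
      U² G a b
        ≡⟨ U²-concentrated a b ⟩
      arcTerm G (adj G vb ua) (λ e′ → U G a (vb , ua , e′) * U G (vb , ua , e′) b)
        ≡⟨ arcTerm-edge (adj G vb ua) _ e ⟩
      U G a (vb , ua , e) * U G (vb , ua , e) b
        ≡⟨ cong₂ _*_ (U-consecutive a vb e) (U-consecutive (vb , ua , e) ub eb) ⟩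
      (twoOver G (deg G ua) - δV G va vb) * (twoOver G (deg G vb) - δV G ua ub)
        ≡⟨ cong₂ _*_ (cong (λ d → twoOver G d - δV G va vb) (regular ua))
                  (cong (λ d → twoOver G d - δV G ua ub) (regular vb)) ⟩
      (q - δV G va vb) * (q - δV G ua ub) ∎
      where open ≡-Reasoning

    factor-same : {x y : V} → x ≡ y → q - δV G x y < 0ℚ
    factor-same x≡y rewrite δV-same x≡y = ℚ.+-monoˡ-< (- 1ℚ) (proj₂ bounds)

    factor-distinct : {x y : V} → x ≢ y → 0ℚ < q - δV G x y
    factor-distinct x≢y rewrite δV-distinct x≢y =
      subst (0ℚ <_) (sym (ℚ.+-identityʳ q)) (proj₁ bounds)

    sign-identical : (a b : Arc G) → a ≡ b → 0ℚ < U² G a b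
    sign-identical a .a refl = subst (0ℚ <_) (sym (U²-linked a a (reverse-edge a)))
      (neg*neg (factor-same refl) (factor-same refl))

    sign-siblings : (a b : Arc G) → Siblings a b → U² G a b < 0ℚ
    sign-siblings a b (inj₁ (oa≡ob , a≢b)) =
      subst (_< 0ℚ) (sym (U²-linked a b (subst (λ x → T (adj G (t G b) x)) (sym oa≡ob) (reverse-edge b))))
        (pos*neg (factor-distinct (λ ta≡tb → a≢b (arc-≡ a b oa≡ob ta≡tb))) (factor-same oa≡ob))
    sign-siblings a b (inj₂ (ta≡tb , a≢b)) =
      subst (_< 0ℚ) (sym (U²-linked a b (subst (λ x → T (adj G x (o G a))) ta≡tb (reverse-edge a))))
        (neg*pos (factor-same ta≡tb) (factor-distinct (λ oa≡ob → a≢b (arc-≡ a b oa≡ob ta≡tb))))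

    sign-linked : (a b : Arc G) → T (adj G (t G b) (o G a)) →
                  o G a ≢ o G b → t G a ≢ t G b → 0ℚ < U² G a b
    sign-linked a b e oa≢ob ta≢tb = subst (0ℚ <_) (sym (U²-linked a b e))
      (pos*pos (factor-distinct ta≢tb) (factor-distinct oa≢ob))

    U²-not-positive : (a b : Arc G) → ¬ T (adj G (t G b) (o G a)) → ¬ (0ℚ < U² G a b)
    U²-not-positive a b ¬e 0<U² = ℚ.<-irrefl refl (subst (0ℚ <_) (U²-unlinked a b ¬e) 0<U²)

    U²-not-negative : (a b : Arc G) → ¬ T (adj G (t G b) (o G a)) → ¬ (U² G a b < 0ℚ)
    U²-not-negative a b ¬e U²<0 = ℚ.<-irrefl refl (subst (_< 0ℚ) (U²-unlinked a b ¬e) U²<0)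

    positive-iff : (a b : Arc G) → (0ℚ < U² G a b) ⇔
      (a ≡ b ⊎ (T (adj G (t G b) (o G a)) × ¬ (a ≡ b ⊎ Siblings a b)))
    positive-iff a b = mk⇔ to from
      where
      to : 0ℚ < U² G a b → a ≡ b ⊎ (T (adj G (t G b) (o G a)) × ¬ (a ≡ b ⊎ Siblings a b))
      to 0<U² with classify a b
      ... | identical a≡b = inj₁ a≡b
      ... | siblings s = ⊥-elim (ℚ.<-asym 0<U² (sign-siblings a b s))
      ... | unlinked ¬e = ⊥-elim (U²-not-positive a b ¬e 0<U²)
      ... | linked e oa≢ob ta≢tb = inj₂ (e , λ
              { (inj₁ a≡b) → oa≢ob (cong (o G) a≡b)
              ; (inj₂ (inj₁ (oa≡ob , _))) → oa≢ob oa≡ob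
              ; (inj₂ (inj₂ (ta≡tb , _))) → ta≢tb ta≡tb })
      from : a ≡ b ⊎ (T (adj G (t G b) (o G a)) × ¬ (a ≡ b ⊎ Siblings a b)) → 0ℚ < U² G a b
      from (inj₁ a≡b) = sign-identical a b a≡b
      from (inj₂ (e , apart)) = sign-linked a b e
        (λ oa≡ob → apart (inj₂ (inj₁ (oa≡ob , λ a≡b → apart (inj₁ a≡b)))))
        (λ ta≡tb → apart (inj₂ (inj₂ (ta≡tb , λ a≡b → apart (inj₁ a≡b)))))

    negative-iff : (a b : Arc G) → (U² G a b < 0ℚ) ⇔ Siblings a b
    negative-iff a b = mk⇔ to (sign-siblings a b)
      where
      to : U² G a b < 0ℚ → Siblings a b
      to U²<0 with classify a b
      ... | identical a≡b = ⊥-elim (ℚ.<-asym U²<0 (sign-identical a b a≡b))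
      ... | siblings s = s
      ... | linked e oa≢ob ta≢tb = ⊥-elim (ℚ.<-asym U²<0 (sign-linked a b e oa≢ob ta≢tb))
      ... | unlinked ¬e = ⊥-elim (U²-not-negative a b ¬e U²<0)

corollary6p7 : (G : Graph) (k : ℕ) → Connected G → Regular G k → 3 ≤ k →
    (a b : Arc G) →
    ((0ℚ < U² G a b) ⇔
      (a ≡ b ⊎
        (T (adj G (t G b) (o G a)) ×
          ¬ (a ≡ b ⊎ (o G a ≡ o G b × a ≢ b) ⊎ (t G a ≡ t G b × a ≢ b)))))
    × ((U² G a b < 0ℚ) ⇔ ((o G a ≡ o G b × a ≢ b) ⊎ (t G a ≡ t G b × a ≢ b)))
corollary6p7 G k _ regular k≥3 a b = positive-iff a b , negative-iff a b
  where open RegularSigns G k regular (twoOver-bounds G k k≥3)
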